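{- If $\mathcal{M}$ is a stable structure then every structure trace definable in $\mathcal{M}$ is stable. If $\mathcal{M}$ is an $\mathrm{NIP}$ structure then every structure trace definable in $\mathcal{M}$ is $\mathrm{NIP}$.
   Context: Trace definability: for structures $\mathcal{O},\mathcal{M}$ and an injection $\tau : O \to M^m$, $\mathcal{M}$ trace defines $\mathcal{O}$ via $\tau$ if for every $\mathcal{O}$-definable (with parameters) $X \subseteq O^n$ there is an $\mathcal{M}$-definable (with parameters) $Y \subseteq M^{mn}$ with $X = \{(a_1,\dots,a_n) \in O^n : (\tau(a_1),\dots,\tau(a_n)) \in Y\}$; $\mathcal{O}$ is trace definable in $\mathcal{M}$ if this holds for some such injection. -}

module Defs where

open import Data.Nat using (ℕ; _+_; _*_; _<_)
open import Data.Fin using (Fin; toℕ)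
open import Data.Fin.Subset using (Subset; _∈_)
open import Data.Vec using (Vec; lookup; _++_; concat; map)
open import Data.Product using (Σ; _×_; _,_)
open import Data.Sum using (_⊎_)
open import Data.Empty using (⊥)
open import Data.Unit using (⊤)
open import Relation.Nullary using (¬_)
open import Relation.Binary.PropositionalEquality using (_≡_)
open import Function.Bundles using (_⇔_)
open import Function.Definitions using (Injective)

-- A (one-sorted, first-order) language: function symbols (constants are
-- 0-ary functions) and relation symbols, each with an arity.
record Language : Set₁ where
  field
    Func     : Set
    funArity : Func → ℕ
    Rel      : Set
    relArity : Rel → ℕ

record Structure (L : Language) : Set₁ where
  open Language L
  field
    Carrier : Set
    funInterp : (f : Func) → (Fin (funArity f) → Carrier) → Carrier
    relInterp : (r : Rel) → (Fin (relArity r) → Carrier) → Set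

module _ (L : Language) where
  open Language L

  data Term (n : ℕ) : Set where
    var : Fin n → Term n
    app : (f : Func) → (Fin (funArity f) → Term n) → Term n

  data Formula : ℕ → Set where
    tt ff    : ∀ {n} → Formula n
    _≐_      : ∀ {n} → Term n → Term n → Formula n
    rel      : ∀ {n} (r : Rel) → (Fin (relArity r) → Term n) → Formula n
    ~_       : ∀ {n} → Formula n → Formula n
    _∧_ _∨_ _⇒_ : ∀ {n} → Formula n → Formula n → Formula n
    all ex   : ∀ {n} → Formula (ℕ.suc n) → Formula n

module _ {L : Language} (M : Structure L) where
  open Language L
  open Structure M
  open import Data.Vec using (_∷_)

  eval : ∀ {n} → Vec Carrier n → Term L n → Carrier
  eval ρ (var i)   = lookup ρ i
  eval ρ (app f t) = funInterp f (λ i → eval ρ (t i))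

  -- Tarskian satisfaction (variable 0 is the most recently bound one).
  Sat : ∀ {n} → Vec Carrier n → Formula L n → Set
  Sat ρ tt        = ⊤
  Sat ρ ff        = ⊥
  Sat ρ (s ≐ t)   = eval ρ s ≡ eval ρ t
  Sat ρ (rel r t) = relInterp r (λ i → eval ρ (t i))
  Sat ρ (~ φ)     = ¬ Sat ρ φ
  Sat ρ (φ ∧ ψ)   = Sat ρ φ × Sat ρ ψ
  Sat ρ (φ ∨ ψ)   = Sat ρ φ ⊎ Sat ρ ψ
  Sat ρ (φ ⇒ ψ)   = Sat ρ φ → Sat ρ ψ
  Sat ρ (all φ)   = (a : Carrier) → Sat (a ∷ ρ) φ
  Sat ρ (ex φ)    = Σ Carrier λ a → Sat (a ∷ ρ) φ

  -- A definable (with parameters) subset of M^n: a formula φ(x̄; c̄) with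
  -- n object variables and k parameter variables, together with parameters.
  record Definable (n : ℕ) : Set where
    constructor defn
    field
      k      : ℕ
      φ      : Formula L (n + k)
      params : Vec Carrier k

  _∈D_ : ∀ {n} → Vec Carrier n → Definable n → Set
  a ∈D defn k φ c = Sat (a ++ c) φ

  OrderProperty : ∀ p q → Definable (p + q) → Set
  OrderProperty p q X = (N : ℕ) →
    Σ (Fin N → Vec Carrier p) λ a → Σ (Fin N → Vec Carrier q) λ b →
      ∀ i j → ((a i ++ b j) ∈D X) ⇔ (toℕ i < toℕ j)

  IndependenceProperty : ∀ p q → Definable (p + q) → Set
  IndependenceProperty p q X = (N : ℕ) →
    Σ (Fin N → Vec Carrier p) λ a → Σ (Subset N → Vec Carrier q) λ b →
      ∀ i S → ((a i ++ b S) ∈D X) ⇔ (i ∈ S)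

  Stable : Set
  Stable = ∀ p q (X : Definable (p + q)) → ¬ OrderProperty p q X

  NIP : Set
  NIP = ∀ p q (X : Definable (p + q)) → ¬ IndependenceProperty p q X

TraceDefinesVia : ∀ {L L'} (M : Structure L) (O : Structure L') (m : ℕ) →
  (Structure.Carrier O → Vec (Structure.Carrier M) m) → Set
TraceDefinesVia M O m τ =
  Injective _≡_ _≡_ τ ×
  (∀ n (X : Definable O n) → Σ (Definable M (n * m)) λ Y →
     ∀ (a : Vec (Structure.Carrier O) n) →
       (_∈D_ O a X) ⇔ (_∈D_ M (concat (map τ a)) Y))

TraceDefinableIn : ∀ {L L'} (O : Structure L') (M : Structure L) → Set
TraceDefinableIn O M =
  Σ ℕ λ m → Σ (Structure.Carrier O → Vec (Structure.Carrier M) m) λ τ →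
    TraceDefinesVia M O m τ

-- Tracing a partitioned formula φ(x̄; ȳ) of O in M replaces x̄ and ȳ by
-- blocks of m-tuples, and any order-property or independence-property
-- configuration of φ in O is carried by τ to one of the traced formula in M.
module Submission where

open import Defs
open import Data.Nat using (suc; _+_; _*_)
open import Data.Nat.Properties using (*-distribʳ-+; suc-injective)
open import Data.Product using (Σ; _×_; _,_; proj₁; proj₂)
open import Data.Vec using (Vec; []; _∷_; _++_; concat; map; cast)
open import Data.Vec.Properties using (cast-is-id)
open import Function.Base using (_∘_)
open import Function.Bundles using (_⇔_)
open import Function.Construct.Composition using (_⇔-∘_)
open import Function.Construct.Identity using (⇔-id)
open import Function.Construct.Symmetry using (⇔-sym)
open import Relation.Binary.PropositionalEquality
  using (_≡_; refl; cong; subst)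

private
  variable
    A B : Set

cast-++-reassoc : ∀ {k l m n} .(e : m + n ≡ (m + k) + l) .(e′ : n ≡ k + l)
  (u : Vec A m) {v : Vec A n} {w : Vec A k} {w′ : Vec A l} →
  cast e′ v ≡ w ++ w′ → cast e (u ++ v) ≡ (u ++ w) ++ w′
cast-++-reassoc e e′ []      eq = eq
cast-++-reassoc e e′ (x ∷ u) eq =
  cong (x ∷_) (cast-++-reassoc (suc-injective e) e′ u eq)

concatMap : ∀ {m n} → (A → Vec B m) → Vec A n → Vec B (n * m)
concatMap f xs = concat (map f xs)

concatMap-++ : ∀ {m p q} (f : A → Vec B m) (xs : Vec A p) (ys : Vec A q) →
  cast (*-distribʳ-+ m p q) (concatMap f (xs ++ ys)) ≡ concatMap f xs ++ concatMap f ys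
concatMap-++ f []             ys = cast-is-id refl _
concatMap-++ {m = m} {q = q} f (_∷_ {n = p} x xs) ys =
  cast-++-reassoc (*-distribʳ-+ m (suc p) q) (*-distribʳ-+ m p q) (f x)
    (concatMap-++ f xs ys)

module _ {L : Language} (M : Structure L) where
  open Structure M

  ∈D-subst : ∀ {n n′} (e : n ≡ n′) (Y : Definable M n) {v : Vec Carrier n}
    {w : Vec Carrier n′} → cast e v ≡ w →
    _∈D_ M v Y ⇔ _∈D_ M w (subst (Definable M) e Y)
  ∈D-subst refl Y {v} refl rewrite cast-is-id refl v = ⇔-id _

  module _ {L′ : Language} {O : Structure L′} where
    private
      module O = Structure O

    OrderProperty-transfer : ∀ {p q p′ q′} (X : Definable O (p + q))
      (Y : Definable M (p′ + q′)) (f : Vec O.Carrier p → Vec Carrier p′)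
      (g : Vec O.Carrier q → Vec Carrier q′) →
      (∀ a b → _∈D_ O (a ++ b) X ⇔ _∈D_ M (f a ++ g b) Y) →
      OrderProperty O p q X → OrderProperty M p′ q′ Y
    OrderProperty-transfer X Y f g X⇔Y op N =
      let (a , b , a<b) = op N in
      (λ i → f (a i)) , (λ j → g (b j)) ,
      λ i j → a<b i j ⇔-∘ ⇔-sym (X⇔Y (a i) (b j))

    IndependenceProperty-transfer : ∀ {p q p′ q′} (X : Definable O (p + q))
      (Y : Definable M (p′ + q′)) (f : Vec O.Carrier p → Vec Carrier p′)
      (g : Vec O.Carrier q → Vec Carrier q′) →
      (∀ a b → _∈D_ O (a ++ b) X ⇔ _∈D_ M (f a ++ g b) Y) →
      IndependenceProperty O p q X → IndependenceProperty M p′ q′ Y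
    IndependenceProperty-transfer X Y f g X⇔Y ip N =
      let (a , b , a∈b) = ip N in
      (λ i → f (a i)) , (λ S → g (b S)) ,
      λ i S → a∈b i S ⇔-∘ ⇔-sym (X⇔Y (a i) (b S))

    trace-partitioned : ∀ {m} {τ : O.Carrier → Vec Carrier m} →
      TraceDefinesVia M O m τ → ∀ p q (X : Definable O (p + q)) →
      Σ (Definable M (p * m + q * m)) λ Y →
        ∀ (a : Vec O.Carrier p) (b : Vec O.Carrier q) →
          _∈D_ O (a ++ b) X ⇔ _∈D_ M (concatMap τ a ++ concatMap τ b) Y
    trace-partitioned {m} {τ} trace p q X = subst (Definable M) e Y , X⇔Y
      where
      e : (p + q) * m ≡ p * m + q * m
      e = *-distribʳ-+ m p q
      Y : Definable M ((p + q) * m)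
      Y = proj₁ (proj₂ trace (p + q) X)
      X⇔Y : ∀ (a : Vec O.Carrier p) (b : Vec O.Carrier q) →
        _∈D_ O (a ++ b) X ⇔
        _∈D_ M (concatMap τ a ++ concatMap τ b) (subst (Definable M) e Y)
      X⇔Y a b = ∈D-subst e Y (concatMap-++ τ a b)
            ⇔-∘ proj₂ (proj₂ trace (p + q) X) (a ++ b)

  Stable-trace : ∀ {L′} → Stable M →
    (O : Structure L′) → TraceDefinableIn O M → Stable O
  Stable-trace stable O (m , τ , trace) p q X =
    let (Y , X⇔Y) = trace-partitioned trace p q X in
    stable (p * m) (q * m) Y ∘
      OrderProperty-transfer X Y (concatMap τ) (concatMap τ) X⇔Y

  NIP-trace : ∀ {L′} → NIP M →
    (O : Structure L′) → TraceDefinableIn O M → NIP O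
  NIP-trace nip O (m , τ , trace) p q X =
    let (Y , X⇔Y) = trace-partitioned trace p q X in
    nip (p * m) (q * m) Y ∘
      IndependenceProperty-transfer X Y (concatMap τ) (concatMap τ) X⇔Y

proposition4p7 : ∀ {L L' : Language} (M : Structure L) →
    (Stable M → (O : Structure L') → TraceDefinableIn O M → Stable O) ×
    (NIP M → (O : Structure L') → TraceDefinableIn O M → NIP O)
proposition4p7 M = Stable-trace M , NIP-trace M
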